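{- Let $\Gamma$ be a finite group of order at least $4$ and let $n\ge 2$. Then $\mathrm{ex}(Q_n(\Gamma),M(K_3))=2\binom n2=n(n-1)$. If $n\ge 3$, then every $M(K_3)$-free submatroid of $Q_n(\Gamma)$ with $2\binom n2$ elements contains no joint of $Q_n(\Gamma)$.
   Context: For matroids $M,N$: $M$ is $N$-free if it has no submatroid (restriction) isomorphic to $N$; $\mathrm{ex}(M,N)$ is the maximum number of elements of an $N$-free submatroid of $M$. For a finite group $\Gamma$, $K_n^\Gamma$ is the $\Gamma$-gain graph on $[n]$ with, for each $1\le i<j\le n$ and $x\in\Gamma$, an edge $x_{ij}$ oriented $i\to j$ labelled $x$, and a loop $b_i$ at each vertex $i$. A cycle with at least two edges is balanced if the product of its labels (each raised to $\pm1$ according to whether traversal agrees with orientation) is the identity, otherwise unbalanced; loops are unbalanced. The frame matroid $\mathrm{FM}(G)$ has ground set $E(G)$ and circuits the edge sets of: balanced cycles; two unbalanced cycles sharing exactly one vertex; two vertex-disjoint unbalanced cycles joined by a path meeting them only at its ends; theta subgraphs all of whose cycles are unbalanced. $Q_n(\Gamma)=\mathrm{FM}(K_n^\Gamma)$; its joints are the elements $b_1,\dots,b_n$. $M(K_3)$ is the cycle matroid of a triangle. -}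

module Defs where

open import Level using (0ℓ)
open import Data.Empty using (⊥)
open import Data.Bool using (Bool; true)
open import Data.Nat as ℕ using (ℕ; _≤_)
open import Data.Fin as Fin using (Fin)
open import Data.List using (List; []; _∷_; _++_; length; [_])
open import Data.List.Membership.Propositional using (_∈_; _∉_)
open import Data.List.Relation.Unary.Unique.Propositional using (Unique)
open import Data.Product using (Σ; ∃-syntax; _×_; _,_)
open import Data.Sum using (_⊎_)
open import Relation.Binary.PropositionalEquality using (_≡_; _≢_)
open import Relation.Nullary using (¬_)
open import Relation.Unary using (Pred)
open import Function.Bundles using (_⇔_)
open import Function.Definitions using (Injective)
open import Algebra.Structures using (IsGroup)

-- A finite group, presented (up to isomorphism) on the carrier Fin order,
-- with propositional equality.  |Γ| = order.
record FinGroup : Set where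
  field
    order   : ℕ
    _∙_     : Fin order → Fin order → Fin order
    ε       : Fin order
    _⁻¹     : Fin order → Fin order
    isGroup : IsGroup _≡_ _∙_ ε _⁻¹

-- The Γ-gain graph K_n^Γ and its frame matroid Q_n(Γ) = FM(K_n^Γ),
-- given by its circuits (subsets of edges, as predicates).
module Frame (G : FinGroup) (n : ℕ) where
  open FinGroup G

  V : Set
  V = Fin n

  -- joint i  is the loop b_i;  arc i j p x  is the edge x_ij oriented i → j (i < j).
  data Edge : Set where
    joint : V → Edge
    arc   : (i j : V) → i Fin.< j → Fin order → Edge

  data Trav : V → Edge → V → Set where
    fwd : ∀ {i j} (p : i Fin.< j) (x : Fin order) → Trav i (arc i j p x) j
    bwd : ∀ {i j} (p : i Fin.< j) (x : Fin order) → Trav j (arc i j p x) i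

  travGain : ∀ {u e w} → Trav u e w → Fin order
  travGain (fwd p x) = x
  travGain (bwd p x) = x ⁻¹

  data Walk : V → V → Set where
    []   : ∀ {v} → Walk v v
    step : ∀ {u w v e} → Trav u e w → Walk w v → Walk u v

  wEdges : ∀ {u v} → Walk u v → List Edge
  wEdges [] = []
  wEdges (step {e = e} t w) = e ∷ wEdges w

  wStarts : ∀ {u v} → Walk u v → List V
  wStarts [] = []
  wStarts (step {u = u} t w) = u ∷ wStarts w

  wVerts : ∀ {u v} → Walk u v → List V
  wVerts {v = v} w = wStarts w ++ [ v ]

  wGain : ∀ {u v} → Walk u v → Fin order
  wGain [] = ε
  wGain (step t w) = travGain t ∙ wGain w

  IsPath : ∀ {u v} → Walk u v → Set
  IsPath w = Unique (wVerts w)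

  data Cycle : Set where
    loopC : V → Cycle
    walkC : ∀ {v} (w : Walk v v) → 2 ≤ length (wEdges w) →
            Unique (wStarts w) → Unique (wEdges w) → Cycle

  cEdges : Cycle → List Edge
  cEdges (loopC v) = joint v ∷ []
  cEdges (walkC w _ _ _) = wEdges w

  cVerts : Cycle → List V
  cVerts (loopC v) = v ∷ []
  cVerts (walkC w _ _ _) = wStarts w

  Balanced : Cycle → Set
  Balanced (loopC v) = ⊥
  Balanced (walkC w _ _ _) = wGain w ≡ ε

  SameSet : List Edge → Pred Edge 0ℓ → Set
  SameSet l C = ∀ e → (e ∈ l) ⇔ C e

  InternallyDisjoint : ∀ {u v} → Walk u v → Walk u v → Set
  InternallyDisjoint {u} {v} P Q =
    (∀ x → x ∈ wVerts P → x ∈ wVerts Q → x ≡ u ⊎ x ≡ v) ×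
    (∀ e → e ∈ wEdges P → e ∉ wEdges Q)

  data IsCircuit (C : Pred Edge 0ℓ) : Set where
    balancedCycle : (Z : Cycle) → Balanced Z → SameSet (cEdges Z) C → IsCircuit C
    tightHandcuff : (Z₁ Z₂ : Cycle) → ¬ Balanced Z₁ → ¬ Balanced Z₂ →
      (v : V) → (∀ x → (x ∈ cVerts Z₁ × x ∈ cVerts Z₂) ⇔ (x ≡ v)) →
      (∀ e → e ∈ cEdges Z₁ → e ∉ cEdges Z₂) →
      SameSet (cEdges Z₁ ++ cEdges Z₂) C → IsCircuit C
    looseHandcuff : (Z₁ Z₂ : Cycle) → ¬ Balanced Z₁ → ¬ Balanced Z₂ →
      (∀ x → x ∈ cVerts Z₁ → x ∉ cVerts Z₂) →
      ∀ {a b} (P : Walk a b) → IsPath P → a ∈ cVerts Z₁ → b ∈ cVerts Z₂ →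
      (∀ x → x ∈ wVerts P → (x ∈ cVerts Z₁ ⊎ x ∈ cVerts Z₂) → x ≡ a ⊎ x ≡ b) →
      SameSet (cEdges Z₁ ++ cEdges Z₂ ++ wEdges P) C → IsCircuit C
    theta : ∀ {u v} → u ≢ v → (P₁ P₂ P₃ : Walk u v) →
      IsPath P₁ → IsPath P₂ → IsPath P₃ →
      InternallyDisjoint P₁ P₂ → InternallyDisjoint P₁ P₃ → InternallyDisjoint P₂ P₃ →
      (∀ (Z : Cycle) → (∀ e → e ∈ cEdges Z → C e) → ¬ Balanced Z) →
      SameSet (wEdges P₁ ++ wEdges P₂ ++ wEdges P₃) C → IsCircuit C

  -- M(K_3): ground set = the three edges of a triangle (Fin 3); its only
  -- circuit (the only cycle of K_3) is the whole edge set.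
  -- subsets of E(M(K_3)) = Fin 3 are given by characteristic functions
  K3Circuit : (Fin 3 → Bool) → Set
  K3Circuit S = ∀ i → S i ≡ true

  image : (Fin 3 → Edge) → (Fin 3 → Bool) → Pred Edge 0ℓ
  image f S e = ∃[ i ] (S i ≡ true × f i ≡ e)

  -- the restriction of Q_n(Γ) to X has a restriction isomorphic to M(K_3):
  -- an injection f : E(M(K_3)) → X such that for every S ⊆ E(M(K_3)),
  -- S is a circuit of M(K_3) iff f(S) is a circuit of Q_n(Γ) (equivalently of
  -- the restriction, since f(S) ⊆ X).
  HasK3 : Pred Edge 0ℓ → Set
  HasK3 X = Σ (Fin 3 → Edge) λ f → Injective _≡_ _≡_ f × (∀ i → X (f i)) ×
            (∀ (S : Fin 3 → Bool) → IsCircuit (image f S) ⇔ K3Circuit S)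

  -- a submatroid (restriction) of Q_n(Γ), given by a duplicate-free list of
  -- elements, which is M(K_3)-free
  K3Free : List Edge → Set
  K3Free X = Unique X × ¬ HasK3 (λ e → e ∈ X)

  ExEquals : ℕ → Set
  ExEquals k = (∃[ X ] (K3Free X × length X ≡ k)) ×
               (∀ X → K3Free X → length X ≤ k)

module Submission where

-- Upper bound: charge each element of Q_n(Γ) to a pair of vertices: an arc to its ends, a
-- joint to some pair containing it. Any three elements charged to one pair form a circuit of
-- size three (three parallel arcs, a joint with two parallel arcs, or two joints with an arc),
-- hence a copy of M(K₃), so an M(K₃)-free set has at most two elements per pair. For n ≥ 3 a
-- joint in the set also lies on a pair not charged with it, which can then take only one
-- further element, so the bound is not attained.
--
-- Lower bound: as |Γ| ≥ 4, Γ has a sum-free pair {a, b} (no xy = z with x, y, z ∈ {a, b}):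
-- {c, c⁻¹} for any c with c², c³ ≠ 1, or else any a ≠ 1 and b ∉ {1, a, a²}. The arcs labelled
-- a or b form no balanced triangle and no three parallel arcs, and every other circuit has at
-- least four elements, so they contain no M(K₃).

open import Algebra.Bundles using (Group)
import Algebra.Properties.Group as GroupProperties
open import Algebra.Structures using (IsGroup)
open import Data.Bool using (Bool; true; false)
open import Data.Empty using (⊥; ⊥-elim)
open import Data.Fin as Fin using (Fin; zero; suc; toℕ)
import Data.Fin.Properties as FinP
open import Data.List using (List; []; _∷_; _++_; length; map; allFin; cartesianProduct; lookup)
import Data.List.Properties as LP
open import Data.List.Membership.Propositional using (_∈_; _∉_; find; lose)
open import Data.List.Membership.Propositional.Properties
  using (∈-++⁺ˡ; ∈-++⁺ʳ; ∈-map⁺; ∈-map⁻; ∈-allFin; ∈-cartesianProduct⁺; ∈-lookup)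
open import Data.List.Relation.Binary.Permutation.Propositional using (_↭_; prep; swap; ↭-sym; ↭-refl)
open import Data.List.Relation.Binary.Permutation.Propositional.Properties using (∈-resp-↭)
open import Data.List.Relation.Unary.All as All using (All; []; _∷_)
open import Data.List.Relation.Unary.All.Properties using (¬Any⇒All¬)
open import Data.List.Relation.Unary.AllPairs using ([]; _∷_)
open import Data.List.Relation.Unary.Any using (Any; here; there; index; _─_; any?)
open import Data.List.Relation.Unary.Any.Properties using (lookup-index)
open import Data.List.Relation.Unary.Unique.Propositional using (Unique)
import Data.List.Relation.Unary.Unique.Propositional.Properties as Unique
open import Data.Nat using (ℕ; zero; suc; _≤_; _<_; _+_; _*_; z≤n; s≤s)
open import Data.Nat.Combinatorics using (_C_; nC1≡n; nCk+nC[k+1]≡[n+1]C[k+1])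
import Data.Nat.Properties as ℕP
open import Data.Product using (Σ; ∃; ∃-syntax; _×_; _,_; proj₁; proj₂)
open import Data.Sum using (_⊎_; inj₁; inj₂)
open import Function using (case_of_; _∘_)
open import Function.Bundles using (mk⇔; Equivalence)
open import Level using (0ℓ)
open import Relation.Binary.Definitions using (tri<; tri≈; tri>)
open import Relation.Binary.PropositionalEquality
open import Relation.Nullary using (¬_; Dec; yes; no; does)
open import Relation.Nullary.Decidable using (¬?; _×-dec_)
open import Relation.Nullary.Negation using (contradiction)

open import Defs

module _ {A : Set} where

  ∈-─⁺ : ∀ {x y} {ys : List A} (x∈ys : x ∈ ys) → y ∈ ys → y ≢ x → y ∈ (ys ─ x∈ys)
  ∈-─⁺ (here refl) (here refl)    y≢x = contradiction refl y≢x
  ∈-─⁺ (here refl) (there y∈ys)   y≢x = y∈ys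
  ∈-─⁺ (there x∈ys) (here refl)   y≢x = here refl
  ∈-─⁺ (there x∈ys) (there y∈ys)  y≢x = there (∈-─⁺ x∈ys y∈ys y≢x)

  Unique-⊆⇒length≤ : ∀ {xs ys : List A} → Unique xs → (∀ {x} → x ∈ xs → x ∈ ys) →
                     length xs ≤ length ys
  Unique-⊆⇒length≤ {[]} _ _ = z≤n
  Unique-⊆⇒length≤ {x ∷ xs} {ys} (x∉xs ∷ uxs) xs⊆ys =
    subst (suc (length xs) ≤_) (sym (LP.length-removeAt′ ys (index x∈ys)))
      (s≤s (Unique-⊆⇒length≤ uxs
        (λ y∈xs → ∈-─⁺ x∈ys (xs⊆ys (there y∈xs)) (λ { refl → All.lookup x∉xs y∈xs refl }))))
    where x∈ys = xs⊆ys (here refl)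

  Unique-map⁺-on : ∀ {B : Set} (f : A → B) {xs : List A} →
                   (∀ {x y} → x ∈ xs → y ∈ xs → f x ≡ f y → x ≡ y) →
                   Unique xs → Unique (map f xs)
  Unique-map⁺-on f {[]} _ [] = []
  Unique-map⁺-on f {x ∷ xs} inj (x∉xs ∷ uxs) =
    All.tabulate fx∉fxs ∷ Unique-map⁺-on f (λ x∈ y∈ → inj (there x∈) (there y∈)) uxs
    where
    fx∉fxs : ∀ {z} → z ∈ map f xs → f x ≢ z
    fx∉fxs z∈ refl with ∈-map⁻ f z∈
    ... | y , y∈xs , fx≡fy = All.lookup x∉xs y∈xs (inj (here refl) (there y∈xs) fx≡fy)

  lookup-injective : ∀ {xs : List A} → Unique xs → ∀ {i j} → lookup xs i ≡ lookup xs j → i ≡ j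
  lookup-injective {_ ∷ _} _        {zero}  {zero}  _  = refl
  lookup-injective {_ ∷ _} (x∉ ∷ _) {zero}  {suc j} eq = ⊥-elim (All.lookup x∉ (∈-lookup j) eq)
  lookup-injective {_ ∷ _} (x∉ ∷ _) {suc i} {zero}  eq = ⊥-elim (All.lookup x∉ (∈-lookup i) (sym eq))
  lookup-injective {_ ∷ _} (_ ∷ u)  {suc i} {suc j} eq = cong suc (lookup-injective u eq)

  ∈-++₃⁺ : ∀ {x} (xs ys : List A) {zs} → x ∈ xs ⊎ x ∈ ys ⊎ x ∈ zs → x ∈ xs ++ ys ++ zs
  ∈-++₃⁺ xs ys (inj₁ x∈xs)        = ∈-++⁺ˡ x∈xs
  ∈-++₃⁺ xs ys (inj₂ (inj₁ x∈ys)) = ∈-++⁺ʳ xs (∈-++⁺ˡ x∈ys)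
  ∈-++₃⁺ xs ys (inj₂ (inj₂ x∈zs)) = ∈-++⁺ʳ xs (∈-++⁺ʳ ys x∈zs)

  disjoint⇒≢ : ∀ {xs ys : List A} → (∀ x → x ∈ xs → x ∉ ys) → ∀ {x y} → x ∈ xs → y ∈ ys → x ≢ y
  disjoint⇒≢ disj x∈xs y∈ys refl = disj _ x∈xs y∈ys

  HasDistinct : ℕ → (A → Set) → Set
  HasDistinct k P = ∃[ xs ] Unique xs × All P xs × length xs ≡ k

  HasDistinct-mono : ∀ {k} {P Q : A → Set} → (∀ {x} → P x → Q x) →
                     HasDistinct k P → HasDistinct k Q
  HasDistinct-mono P⊆Q (xs , u , all , len) = xs , u , All.map P⊆Q all , len

  distinct₃ : ∀ {P : A → Set} {x y z} → P x → P y → P z →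
              x ≢ y → x ≢ z → y ≢ z → HasDistinct 3 P
  distinct₃ px py pz x≢y x≢z y≢z =
    _ , (x≢y ∷ x≢z ∷ []) ∷ (y≢z ∷ []) ∷ [] ∷ [] , px ∷ py ∷ pz ∷ [] , refl

  distinct₄ : ∀ {P : A → Set} {w x y z} → P w → P x → P y → P z →
              w ≢ x → w ≢ y → w ≢ z → x ≢ y → x ≢ z → y ≢ z → HasDistinct 4 P
  distinct₄ pw px py pz w≢x w≢y w≢z x≢y x≢z y≢z =
    _ , (w≢x ∷ w≢y ∷ w≢z ∷ []) ∷ (x≢y ∷ x≢z ∷ []) ∷ (y≢z ∷ []) ∷ [] ∷ [] ,
    pw ∷ px ∷ py ∷ pz ∷ [] , refl

  ¬HasDistinct : ∀ {k} {P : A → Set} (ys : List A) → (∀ {x} → P x → x ∈ ys) →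
                 length ys < k → ¬ HasDistinct k P
  ¬HasDistinct ys P⊆ys len<k (xs , u , all , refl) =
    ℕP.<⇒≱ len<k (Unique-⊆⇒length≤ u (λ x∈xs → P⊆ys (All.lookup all x∈xs)))

length-cartesianProduct : ∀ {A B : Set} (xs : List A) (ys : List B) →
                          length (cartesianProduct xs ys) ≡ length xs * length ys
length-cartesianProduct [] ys = refl
length-cartesianProduct (x ∷ xs) ys = begin
  length (map (x ,_) ys ++ cartesianProduct xs ys)     ≡⟨ LP.length-++ (map (x ,_) ys) ⟩
  length (map (x ,_) ys) + length (cartesianProduct xs ys)
    ≡⟨ cong₂ _+_ (LP.length-map (x ,_) ys) (length-cartesianProduct xs ys) ⟩
  length ys + length xs * length ys                  ∎
  where open ≡-Reasoning

length-allFin : ∀ k → length (allFin k) ≡ k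
length-allFin k = LP.length-tabulate (λ i → i)

∃∉-Fin : ∀ {k} (xs : List (Fin k)) → length xs < k → ∃ λ x → x ∉ xs
∃∉-Fin {k} xs len<k = FinP.¬∀⟶∃¬ k (_∈ xs) (λ x → any? (x FinP.≟_) xs) λ all∈xs →
  ℕP.<⇒≱ len<k (subst (_≤ length xs) (length-allFin k)
                  (Unique-⊆⇒length≤ (Unique.allFin⁺ k) (λ {x} _ → all∈xs x)))

Unique-full⇒∈ : ∀ {k} {xs : List (Fin k)} → Unique xs → length xs ≡ k → ∀ x → x ∈ xs
Unique-full⇒∈ {k} {xs} u len x with any? (x FinP.≟_) xs
... | yes x∈xs = x∈xs
... | no x∉xs  = contradiction
  (subst₂ _<_ len (length-allFin k)
    (Unique-⊆⇒length≤ (¬Any⇒All¬ xs x∉xs ∷ u) (λ {y} _ → ∈-allFin y)))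
  (ℕP.n≮n k)

Pair : ℕ → Set
Pair k = Σ (Fin k) λ i → Σ (Fin k) λ j → i Fin.< j

pairs : (k : ℕ) → List (Pair k)
pairs zero    = []
pairs (suc k) = map withZero (allFin k) ++ map liftPair (pairs k)
  module Pairs where
  withZero : Fin k → Pair (suc k)
  withZero j = zero , suc j , s≤s z≤n
  liftPair : Pair k → Pair (suc k)
  liftPair (i , j , i<j) = suc i , suc j , s≤s i<j

∈-pairs : ∀ {k} (i j : Fin k) (i<j : i Fin.< j) → (i , j , i<j) ∈ pairs k
∈-pairs {suc k} zero    (suc j) (s≤s z≤n) = ∈-++⁺ˡ (∈-map⁺ (Pairs.withZero k) (∈-allFin j))
∈-pairs {suc k} (suc i) (suc j) (s≤s i<j) =
  ∈-++⁺ʳ _ (∈-map⁺ (Pairs.liftPair k) (∈-pairs i j i<j))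

Unique-pairs : ∀ k → Unique (pairs k)
Unique-pairs zero    = []
Unique-pairs (suc k) =
  Unique.++⁺ (Unique.map⁺ withZero-injective (Unique.allFin⁺ k))
             (Unique.map⁺ liftPair-injective (Unique-pairs k)) disjoint
  where
  open Pairs k
  withZero-injective : ∀ {i j} → withZero i ≡ withZero j → i ≡ j
  withZero-injective refl = refl
  liftPair-injective : ∀ {p q} → liftPair p ≡ liftPair q → p ≡ q
  liftPair-injective {_ , _ , _} {_ , _ , _} refl = refl
  disjoint : ∀ {p} → ¬ (p ∈ map withZero (allFin k) × p ∈ map liftPair (pairs k))
  disjoint (p∈₁ , p∈₂) with ∈-map⁻ withZero p∈₁ | ∈-map⁻ liftPair p∈₂
  ... | _ , _ , refl | (_ , _ , _) , _ , ()

length-pairs : ∀ k → length (pairs k) ≡ k C 2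
length-pairs zero    = refl
length-pairs (suc k) = begin
  length (map withZero (allFin k) ++ map liftPair (pairs k))
    ≡⟨ LP.length-++ (map withZero (allFin k)) ⟩
  length (map withZero (allFin k)) + length (map liftPair (pairs k))
    ≡⟨ cong₂ _+_ (trans (LP.length-map withZero (allFin k)) (length-allFin k))
                 (trans (LP.length-map liftPair (pairs k)) (length-pairs k)) ⟩
  k + k C 2        ≡⟨ cong (_+ k C 2) (sym (nC1≡n k)) ⟩
  k C 1 + k C 2    ≡⟨ nCk+nC[k+1]≡[n+1]C[k+1] k 1 ⟩
  suc k C 2        ∎
  where
  open Pairs k
  open ≡-Reasoning

taggedPairs : (k : ℕ) → List (Bool × Pair k)
taggedPairs k = cartesianProduct (false ∷ true ∷ []) (pairs k)

∈-taggedPairs : ∀ {k} β (p : Pair k) → (β , p) ∈ taggedPairs k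
∈-taggedPairs {k} β (i , j , i<j) =
  ∈-cartesianProduct⁺ {xs = false ∷ true ∷ []} {ys = pairs k} (β∈ β) (∈-pairs i j i<j)
  where
  β∈ : ∀ β → β ∈ false ∷ true ∷ []
  β∈ false = here refl
  β∈ true  = there (here refl)

Unique-taggedPairs : ∀ k → Unique (taggedPairs k)
Unique-taggedPairs k = Unique.cartesianProduct⁺ (((λ ()) ∷ []) ∷ [] ∷ []) (Unique-pairs k)

length-taggedPairs : ∀ k → length (taggedPairs k) ≡ 2 * (k C 2)
length-taggedPairs k =
  trans (length-cartesianProduct (false ∷ true ∷ []) (pairs k)) (cong (2 *_) (length-pairs k))

module SumFreeSets {A : Set} {_∙_ : A → A → A} {ε : A} {_⁻¹ : A → A}
                   (isGroup : IsGroup _≡_ _∙_ ε _⁻¹) where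
  open IsGroup isGroup using (assoc; identityʳ; inverseˡ; inverseʳ)
  private
    group : Group 0ℓ 0ℓ
    group = record { isGroup = isGroup }
  open GroupProperties group
    using (identityˡ-unique; identityʳ-unique; ⁻¹-injective; ε⁻¹≈ε; ⁻¹-anti-homo-∙)

  OneOf : A → A → A → Set
  OneOf a b x = x ≡ a ⊎ x ≡ b

  SumFree : (A → Set) → Set
  SumFree S = ∀ {x y} → S x → S y → ¬ S (x ∙ y)

  sumFree-pair : ∀ {a b} → a ≢ ε → b ≢ ε → a ∙ a ≢ b → b ∙ b ≢ a → SumFree (OneOf a b)
  sumFree-pair {a} {b} a≢ε b≢ε aa≢b bb≢a = λ where
    (inj₁ refl) (inj₁ refl) (inj₁ aa≡a) → a≢ε (identityʳ-unique a a aa≡a)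
    (inj₁ refl) (inj₁ refl) (inj₂ aa≡b) → aa≢b aa≡b
    (inj₁ refl) (inj₂ refl) (inj₁ ab≡a) → b≢ε (identityʳ-unique a b ab≡a)
    (inj₁ refl) (inj₂ refl) (inj₂ ab≡b) → a≢ε (identityˡ-unique a b ab≡b)
    (inj₂ refl) (inj₁ refl) (inj₁ ba≡a) → b≢ε (identityˡ-unique b a ba≡a)
    (inj₂ refl) (inj₁ refl) (inj₂ ba≡b) → a≢ε (identityʳ-unique b a ba≡b)
    (inj₂ refl) (inj₂ refl) (inj₁ bb≡a) → bb≢a bb≡a
    (inj₂ refl) (inj₂ refl) (inj₂ bb≡b) → b≢ε (identityʳ-unique b b bb≡b)

  module _ {c : A} (cc≢ε : c ∙ c ≢ ε) (ccc≢ε : c ∙ (c ∙ c) ≢ ε) where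

    c≢c⁻¹ : c ≢ c ⁻¹
    c≢c⁻¹ c≡c⁻¹ = cc≢ε (trans (cong (c ∙_) c≡c⁻¹) (inverseʳ c))

    sumFree-inversePair : SumFree (OneOf c (c ⁻¹))
    sumFree-inversePair = sumFree-pair c≢ε c⁻¹≢ε cc≢c⁻¹ c⁻¹c⁻¹≢c
      where
      c≢ε : c ≢ ε
      c≢ε refl = cc≢ε (identityʳ ε)
      c⁻¹≢ε : c ⁻¹ ≢ ε
      c⁻¹≢ε c⁻¹≡ε = c≢ε (⁻¹-injective (trans c⁻¹≡ε (sym ε⁻¹≈ε)))
      cc≢c⁻¹ : c ∙ c ≢ c ⁻¹
      cc≢c⁻¹ cc≡c⁻¹ = ccc≢ε (trans (cong (c ∙_) cc≡c⁻¹) (inverseʳ c))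
      c⁻¹c⁻¹≢c : (c ⁻¹) ∙ (c ⁻¹) ≢ c
      c⁻¹c⁻¹≢c c⁻¹c⁻¹≡c = ccc≢ε (begin
        c ∙ (c ∙ c)                  ≡⟨ cong (_∙ (c ∙ c)) (sym c⁻¹c⁻¹≡c) ⟩
        ((c ⁻¹) ∙ (c ⁻¹)) ∙ (c ∙ c)  ≡⟨ cong (_∙ (c ∙ c)) (sym (⁻¹-anti-homo-∙ c c)) ⟩
        ((c ∙ c) ⁻¹) ∙ (c ∙ c)       ≡⟨ inverseˡ (c ∙ c) ⟩
        ε                            ∎)
        where open ≡-Reasoning

  sumFree-lowOrder : ∀ {a b} → a ≢ ε → b ∉ ε ∷ a ∷ a ∙ a ∷ [] →
                     b ∙ b ≡ ε ⊎ b ∙ (b ∙ b) ≡ ε → SumFree (OneOf a b)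
  sumFree-lowOrder {a} {b} a≢ε b∉ b-order =
    sumFree-pair a≢ε (λ eq → b∉ (here eq)) (λ eq → b∉ (there (there (here (sym eq))))) bb≢a
    where
    open ≡-Reasoning
    b≡aa : b ∙ b ≡ a → b ∙ (b ∙ b) ≡ ε → b ≡ a ∙ a
    b≡aa bb≡a bbb≡ε = begin
      b                  ≡⟨ sym (identityʳ b) ⟩
      b ∙ ε              ≡⟨ cong (b ∙_) (sym bbb≡ε) ⟩
      b ∙ (b ∙ (b ∙ b))  ≡⟨ sym (assoc b b (b ∙ b)) ⟩
      (b ∙ b) ∙ (b ∙ b)  ≡⟨ cong₂ _∙_ bb≡a bb≡a ⟩
      a ∙ a              ∎
    bb≢a : b ∙ b ≢ a
    bb≢a bb≡a = case b-order of λ where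
      (inj₁ bb≡ε)  → a≢ε (trans (sym bb≡a) bb≡ε)
      (inj₂ bbb≡ε) → b∉ (there (there (here (b≡aa bb≡a bbb≡ε))))

module BalancedTriangles {A : Set} {_∙_ : A → A → A} {ε : A} {_⁻¹ : A → A}
                        (isGroup : IsGroup _≡_ _∙_ ε _⁻¹) where
  open IsGroup isGroup using (assoc; inverseʳ)
  private
    group : Group 0ℓ 0ℓ
    group = record { isGroup = isGroup }
  open GroupProperties group using (inverseˡ-unique; x∙y⁻¹≈ε⇒x≈y; ⁻¹-anti-homo-∙; ⁻¹-involutive)
  open ≡-Reasoning

  rotate : ∀ {x y z} → x ∙ (y ∙ z) ≡ ε → y ∙ (z ∙ x) ≡ ε
  rotate {x} {y} {z} xyz≡ε = begin
    y ∙ (z ∙ x)            ≡⟨ sym (assoc y z x) ⟩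
    (y ∙ z) ∙ x            ≡⟨ cong ((y ∙ z) ∙_) (inverseˡ-unique x (y ∙ z) xyz≡ε) ⟩
    (y ∙ z) ∙ ((y ∙ z) ⁻¹) ≡⟨ inverseʳ (y ∙ z) ⟩
    ε                      ∎

  solve : ∀ {x y z} → x ∙ (y ∙ (z ⁻¹)) ≡ ε → x ∙ y ≡ z
  solve {x} {y} {z} xyz⁻¹≡ε = x∙y⁻¹≈ε⇒x≈y (x ∙ y) z (trans (assoc x y (z ⁻¹)) xyz⁻¹≡ε)

  solve⁻¹ : ∀ {x y z} → x ∙ ((y ⁻¹) ∙ (z ⁻¹)) ≡ ε → z ∙ y ≡ x
  solve⁻¹ {x} {y} {z} xy⁻¹z⁻¹≡ε = sym (begin
    x                                ≡⟨ inverseˡ-unique x ((y ⁻¹) ∙ (z ⁻¹)) xy⁻¹z⁻¹≡ε ⟩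
    ((y ⁻¹) ∙ (z ⁻¹)) ⁻¹             ≡⟨ ⁻¹-anti-homo-∙ (y ⁻¹) (z ⁻¹) ⟩
    ((z ⁻¹) ⁻¹) ∙ ((y ⁻¹) ⁻¹)        ≡⟨ cong₂ _∙_ (⁻¹-involutive z) (⁻¹-involutive y) ⟩
    z ∙ y                            ∎)

module _ (G : FinGroup) where
  open FinGroup G
  open SumFreeSets isGroup

  ∃-sumFreePair : 4 ≤ order → ∃[ a ] ∃[ b ] a ≢ b × SumFree (OneOf a b)
  ∃-sumFreePair 4≤order with FinP.any? (λ c → ¬? (c ∙ c FinP.≟ ε) ×-dec ¬? (c ∙ (c ∙ c) FinP.≟ ε))
  ... | yes (c , cc≢ε , ccc≢ε) = c , c ⁻¹ , c≢c⁻¹ cc≢ε ccc≢ε , sumFree-inversePair cc≢ε ccc≢ε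
  ... | no ∄c
    with a , a∉ ← ∃∉-Fin (ε ∷ []) (ℕP.<-≤-trans (s≤s (s≤s z≤n)) 4≤order)
    with b , b∉ ← ∃∉-Fin (ε ∷ a ∷ a ∙ a ∷ []) 4≤order
    = a , b , (λ a≡b → b∉ (there (here (sym a≡b))))
    , sumFree-lowOrder (λ a≡ε → a∉ (here a≡ε)) b∉ (lowOrder ∄c b)
    where
    lowOrder : ¬ (∃ λ c → c ∙ c ≢ ε × c ∙ (c ∙ c) ≢ ε) → ∀ c → c ∙ c ≡ ε ⊎ c ∙ (c ∙ c) ≡ ε
    lowOrder ∄c c with c ∙ c FinP.≟ ε | c ∙ (c ∙ c) FinP.≟ ε
    ... | yes cc≡ε | _         = inj₁ cc≡ε
    ... | no _     | yes ccc≡ε = inj₂ ccc≡ε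
    ... | no cc≢ε  | no ccc≢ε  = contradiction (c , cc≢ε , ccc≢ε) ∄c

module FrameMatroid (G : FinGroup) (n : ℕ) where
  open FinGroup G
  open Frame G n
  open IsGroup isGroup using (identityʳ)
  private
    group : Group 0ℓ 0ℓ
    group = record { isGroup = isGroup }
  open GroupProperties group using (x∙y⁻¹≈ε⇒x≈y; inverseˡ-unique; ⁻¹-injective)
  open SumFreeSets isGroup using (SumFree; OneOf)

  Incident : Edge → V → Set
  Incident (joint i)     x = x ≡ i
  Incident (arc i j _ _) x = x ≡ i ⊎ x ≡ j

  incident-start : ∀ {u e w} → Trav u e w → Incident e u
  incident-start (fwd _ _) = inj₁ refl
  incident-start (bwd _ _) = inj₂ refl

  incident-end : ∀ {u e w} → Trav u e w → Incident e w
  incident-end (fwd _ _) = inj₂ refl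
  incident-end (bwd _ _) = inj₁ refl

  incident-Trav : ∀ {u e w x} → Trav u e w → Incident e x → x ≡ u ⊎ x ≡ w
  incident-Trav (fwd _ _) x∈e = x∈e
  incident-Trav (bwd _ _) (inj₁ x≡i) = inj₂ x≡i
  incident-Trav (bwd _ _) (inj₂ x≡j) = inj₁ x≡j

  anEnd : ∀ e → ∃ (Incident e)
  anEnd (joint i)     = i , refl
  anEnd (arc i _ _ _) = i , inj₁ refl

  start∈wVerts : ∀ {u v} (W : Walk u v) → u ∈ wVerts W
  start∈wVerts []         = here refl
  start∈wVerts (step _ _) = here refl

  incident-walk : ∀ {u v e x} (W : Walk u v) → e ∈ wEdges W → Incident e x →
                  x ∈ wStarts W ⊎ x ≡ v
  incident-walk (step t W) (here refl) x∈e with incident-Trav t x∈e | W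
  ... | inj₁ refl | _        = inj₁ (here refl)
  ... | inj₂ refl | []       = inj₂ refl
  ... | inj₂ refl | step _ _ = inj₁ (there (here refl))
  incident-walk (step t W) (there e∈W) x∈e with incident-walk W e∈W x∈e
  ... | inj₁ x∈W = inj₁ (there x∈W)
  ... | inj₂ x≡v = inj₂ x≡v

  incident-cycle : ∀ Z {e x} → e ∈ cEdges Z → Incident e x → x ∈ cVerts Z
  incident-cycle (loopC v) (here refl) refl = here refl
  incident-cycle (walkC W@(step _ _) _ _ _) e∈Z x∈e with incident-walk W e∈Z x∈e
  ... | inj₁ x∈Z = x∈Z
  ... | inj₂ refl = here refl

  label : Edge → Fin order
  label (joint _)     = ε
  label (arc _ _ _ x) = x

  arc-cong : ∀ {i j} (p q : i Fin.< j) {x y} → x ≡ y → arc i j p x ≡ arc i j q y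
  arc-cong p q {x} refl = cong (λ r → arc _ _ r x) (FinP.<-irrelevant p q)

  <⇒≢ : ∀ {i j : V} → i Fin.< j → i ≢ j
  <⇒≢ i<j refl = FinP.<-irrefl refl i<j

  balancedDigon⇒≡ : ∀ {v w e₁ e₂} (t₁ : Trav v e₁ w) (t₂ : Trav w e₂ v) →
                    travGain t₁ ∙ (travGain t₂ ∙ ε) ≡ ε → e₁ ≡ e₂
  balancedDigon⇒≡ (fwd p x) (fwd q y) _ = ⊥-elim (FinP.<-asym p q)
  balancedDigon⇒≡ (bwd p x) (bwd q y) _ = ⊥-elim (FinP.<-asym p q)
  balancedDigon⇒≡ (fwd p x) (bwd q y) bal = arc-cong p q
    (x∙y⁻¹≈ε⇒x≈y x y (trans (cong (x ∙_) (sym (identityʳ (y ⁻¹)))) bal))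
  balancedDigon⇒≡ (bwd p x) (fwd q y) bal = arc-cong p q
    (⁻¹-injective (inverseˡ-unique (x ⁻¹) y (trans (cong ((x ⁻¹) ∙_) (sym (identityʳ y))) bal)))

  ⇔⇒⊆ : ∀ {l K} → SameSet l K → ∀ {e} → e ∈ l → K e
  ⇔⇒⊆ l≈K e∈l = Equivalence.to (l≈K _) e∈l

  twoEdges : ∀ {v} (W : Walk v v) → 2 ≤ length (wEdges W) → Unique (wEdges W) →
             ∃[ e ] ∃[ e′ ] e ∈ wEdges W × e′ ∈ wEdges W × e ≢ e′
  twoEdges (step _ [])         (s≤s ()) _
  twoEdges (step _ (step _ _)) _        ((e≢e′ ∷ _) ∷ _) = _ , _ , here refl , there (here refl) , e≢e′

  anEdge : ∀ Z → ∃ (_∈ cEdges Z)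
  anEdge (loopC _)                = _ , here refl
  anEdge (walkC (step _ _) _ _ _) = _ , here refl

  vertexDisjoint⇒edgeDisjoint : ∀ Z₁ Z₂ → (∀ x → x ∈ cVerts Z₁ → x ∉ cVerts Z₂) →
                                ∀ {e e′} → e ∈ cEdges Z₁ → e′ ∈ cEdges Z₂ → e ≢ e′
  vertexDisjoint⇒edgeDisjoint Z₁ Z₂ disj e∈Z₁ e∈Z₂ refl =
    disj _ (incident-cycle Z₁ e∈Z₁ x∈e) (incident-cycle Z₂ e∈Z₂ x∈e)
    where x∈e = proj₂ (anEnd _)

  circuit⇒three : ∀ {K} → IsCircuit K → HasDistinct 3 K
  circuit⇒three (balancedCycle (loopC _) () _)
  circuit⇒three (balancedCycle (walkC (step _ []) (s≤s ()) _ _) _ _)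
  circuit⇒three (balancedCycle (walkC (step t₁ (step t₂ [])) _ _ ((e₁≢e₂ ∷ _) ∷ _)) bal _) =
    contradiction (balancedDigon⇒≡ t₁ t₂ bal) e₁≢e₂
  circuit⇒three (balancedCycle (walkC (step _ (step _ (step _ _))) _ _
                  ((e₁≢e₂ ∷ e₁≢e₃ ∷ _) ∷ (e₂≢e₃ ∷ _) ∷ _)) _ Z≈K) =
    distinct₃ (⇔⇒⊆ Z≈K (here refl)) (⇔⇒⊆ Z≈K (there (here refl)))
              (⇔⇒⊆ Z≈K (there (there (here refl)))) e₁≢e₂ e₁≢e₃ e₂≢e₃
  circuit⇒three (tightHandcuff (loopC _) (loopC _) _ _ v meet disj _)
    with Equivalence.from (meet v) refl
  ... | here refl , here refl = contradiction (here refl) (disj _ (here refl))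
  circuit⇒three (tightHandcuff (loopC a) (walkC W len _ uW) _ _ _ _ disj Z≈K)
    with e , e′ , e∈W , e′∈W , e≢e′ ← twoEdges W len uW =
    distinct₃ (⇔⇒⊆ Z≈K (there e∈W)) (⇔⇒⊆ Z≈K (there e′∈W)) (⇔⇒⊆ Z≈K (here refl))
              e≢e′ (disjoint⇒≢ disj (here refl) e∈W ∘ sym) (disjoint⇒≢ disj (here refl) e′∈W ∘ sym)
  circuit⇒three (tightHandcuff (walkC W len _ uW) Z₂ _ _ _ _ disj Z≈K)
    with e , e′ , e∈W , e′∈W , e≢e′ ← twoEdges W len uW
       | f , f∈Z₂ ← anEdge Z₂ =
    distinct₃ (⇔⇒⊆ Z≈K (∈-++⁺ˡ e∈W)) (⇔⇒⊆ Z≈K (∈-++⁺ˡ e′∈W)) (⇔⇒⊆ Z≈K (∈-++⁺ʳ (wEdges W) f∈Z₂))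
              e≢e′ (disjoint⇒≢ disj e∈W f∈Z₂) (disjoint⇒≢ disj e′∈W f∈Z₂)
  circuit⇒three (looseHandcuff _ _ _ _ disj [] _ a∈Z₁ a∈Z₂ _ _) =
    contradiction a∈Z₂ (disj _ a∈Z₁)
  circuit⇒three (looseHandcuff Z₁ Z₂ _ _ disj {a} {b} (step {w = w} {e = e} t P) (a∉P ∷ _)
                                a∈Z₁ b∈Z₂ inner Z≈K)
    with e₁ , e₁∈Z₁ ← anEdge Z₁ | e₂ , e₂∈Z₂ ← anEdge Z₂ =
    distinct₃ (⇔⇒⊆ Z≈K (∈-++⁺ˡ e₁∈Z₁)) (⇔⇒⊆ Z≈K (∈-++⁺ʳ (cEdges Z₁) (∈-++⁺ˡ e₂∈Z₂)))
              (⇔⇒⊆ Z≈K (∈-++⁺ʳ (cEdges Z₁) (∈-++⁺ʳ (cEdges Z₂) (here refl))))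
              (vertexDisjoint⇒edgeDisjoint Z₁ Z₂ disj e₁∈Z₁ e₂∈Z₂) e₁≢t e₂≢t
    where
    e₁≢t : e₁ ≢ e
    e₁≢t refl with w∈Z₁ ← incident-cycle Z₁ e₁∈Z₁ (incident-end t)
                 | inner w (there (start∈wVerts P)) (inj₁ w∈Z₁)
    ... | inj₁ refl = All.lookup a∉P (start∈wVerts P) refl
    ... | inj₂ refl = disj b w∈Z₁ b∈Z₂
    e₂≢t : e₂ ≢ e
    e₂≢t refl = disj a a∈Z₁ (incident-cycle Z₂ e₂∈Z₂ (incident-start t))
  circuit⇒three (theta u≢v [] _ _ _ _ _ _ _ _ _ _) = contradiction refl u≢v
  circuit⇒three (theta u≢v (step _ _) [] _ _ _ _ _ _ _ _ _) = contradiction refl u≢v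
  circuit⇒three (theta u≢v (step _ _) (step _ _) [] _ _ _ _ _ _ _ _) = contradiction refl u≢v
  circuit⇒three (theta _ P₁@(step _ _) P₂@(step _ _) (step _ _) _ _ _
                        (_ , d₁₂) (_ , d₁₃) (_ , d₂₃) _ P≈K) =
    distinct₃ (⇔⇒⊆ P≈K (here refl)) (⇔⇒⊆ P≈K (∈-++⁺ʳ (wEdges P₁) (here refl)))
              (⇔⇒⊆ P≈K (∈-++⁺ʳ (wEdges P₁) (∈-++⁺ʳ (wEdges P₂) (here refl))))
              (disjoint⇒≢ d₁₂ (here refl) (here refl))
              (disjoint⇒≢ d₁₃ (here refl) (here refl))
              (disjoint⇒≢ d₂₃ (here refl) (here refl))

  TripleCircuit : Edge → Edge → Edge → Set₁
  TripleCircuit e₁ e₂ e₃ = ∀ K → SameSet (e₁ ∷ e₂ ∷ e₃ ∷ []) K → IsCircuit K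

  TripleCircuit-resp-↭ : ∀ {e₁ e₂ e₃ f₁ f₂ f₃} → e₁ ∷ e₂ ∷ e₃ ∷ [] ↭ f₁ ∷ f₂ ∷ f₃ ∷ [] →
                         TripleCircuit e₁ e₂ e₃ → TripleCircuit f₁ f₂ f₃
  TripleCircuit-resp-↭ σ circuit K f≈K = circuit K λ e →
    mk⇔ (Equivalence.to (f≈K e) ∘ ∈-resp-↭ σ) (∈-resp-↭ (↭-sym σ) ∘ Equivalence.from (f≈K e))

  TripleCircuit-swap₁₂ : ∀ {e₁ e₂ e₃} → TripleCircuit e₁ e₂ e₃ → TripleCircuit e₂ e₁ e₃
  TripleCircuit-swap₁₂ = TripleCircuit-resp-↭ (swap _ _ ↭-refl)

  TripleCircuit-swap₂₃ : ∀ {e₁ e₂ e₃} → TripleCircuit e₁ e₂ e₃ → TripleCircuit e₁ e₃ e₂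
  TripleCircuit-swap₂₃ = TripleCircuit-resp-↭ (prep _ (swap _ _ ↭-refl))

  start-incident : ∀ {u v x} (W : Walk u v) → x ∈ wStarts W → ∃[ e ] e ∈ wEdges W × Incident e x
  start-incident (step t _) (here refl) = _ , here refl , incident-start t
  start-incident (step _ W) (there x∈W) with e , e∈W , x∈e ← start-incident W x∈W =
    e , there e∈W , x∈e

  cycleOnTwoVertices-unbalanced : ∀ {a b} Z →
    (∀ {e x} → e ∈ cEdges Z → Incident e x → x ∈ a ∷ b ∷ []) → ¬ Balanced Z
  cycleOnTwoVertices-unbalanced (loopC _) _ ()
  cycleOnTwoVertices-unbalanced (walkC (step _ []) (s≤s ()) _ _)
  cycleOnTwoVertices-unbalanced (walkC (step t₁ (step t₂ [])) _ _ ((e₁≢e₂ ∷ _) ∷ _)) _ bal =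
    e₁≢e₂ (balancedDigon⇒≡ t₁ t₂ bal)
  cycleOnTwoVertices-unbalanced (walkC W@(step _ (step _ (step _ _))) _ uStarts _) onAB _ =
    contradiction (Unique-⊆⇒length≤ uStarts starts⊆ab) λ { (s≤s (s≤s ())) }
    where
    starts⊆ab : ∀ {x} → x ∈ wStarts W → x ∈ _ ∷ _ ∷ []
    starts⊆ab x∈W with e , e∈W , x∈e ← start-incident W x∈W = onAB e∈W x∈e

  module _ {a b : V} (a<b : a Fin.< b) where

    private
      uniqueAB : Unique (a ∷ b ∷ [])
      uniqueAB = (<⇒≢ a<b ∷ []) ∷ [] ∷ []

      arc≢ : ∀ {x y} → x ≢ y → arc a b a<b x ≢ arc a b a<b y
      arc≢ x≢y = x≢y ∘ cong label

      label≢ : ∀ {x y} → arc a b a<b x ≢ arc a b a<b y → x ≢ y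
      label≢ arcs≢ = arcs≢ ∘ cong (arc a b a<b)

    data OnPair : Edge → Set where
      jointˡ : OnPair (joint a)
      jointʳ : OnPair (joint b)
      arcOn  : ∀ x → OnPair (arc a b a<b x)

    thetaCircuit : ∀ {x y z} → x ≢ y → x ≢ z → y ≢ z →
                   TripleCircuit (arc a b a<b x) (arc a b a<b y) (arc a b a<b z)
    thetaCircuit {x} {y} {z} x≢y x≢z y≢z K P≈K =
      theta (<⇒≢ a<b) (step (fwd a<b x) []) (step (fwd a<b y) []) (step (fwd a<b z) [])
        uniqueAB uniqueAB uniqueAB (parallel x≢y) (parallel x≢z) (parallel y≢z) unbalanced P≈K
      where
      parallel : ∀ {u w} → u ≢ w → InternallyDisjoint (step (fwd a<b u) []) (step (fwd a<b w) [])
      parallel u≢w = (λ { _ (here v≡a) _ → inj₁ v≡a ; _ (there (here v≡b)) _ → inj₂ v≡b })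
                   , (λ { _ (here refl) (here eq) → arc≢ u≢w eq })
      onAB : ∀ {e v} → e ∈ arc a b a<b x ∷ arc a b a<b y ∷ arc a b a<b z ∷ [] →
             Incident e v → v ∈ a ∷ b ∷ []
      onAB (here refl)                 (inj₁ v≡a) = here v≡a
      onAB (here refl)                 (inj₂ v≡b) = there (here v≡b)
      onAB (there (here refl))         (inj₁ v≡a) = here v≡a
      onAB (there (here refl))         (inj₂ v≡b) = there (here v≡b)
      onAB (there (there (here refl))) (inj₁ v≡a) = here v≡a
      onAB (there (there (here refl))) (inj₂ v≡b) = there (here v≡b)
      unbalanced : ∀ Z → (∀ e → e ∈ cEdges Z → K e) → ¬ Balanced Z
      unbalanced Z Z⊆K = cycleOnTwoVertices-unbalanced Z λ e∈Z →
        onAB (Equivalence.from (P≈K _) (Z⊆K _ e∈Z))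

    tightCircuitˡ : ∀ {x y} → x ≢ y → TripleCircuit (joint a) (arc a b a<b x) (arc a b a<b y)
    tightCircuitˡ {x} {y} x≢y _ =
      tightHandcuff (loopC a) (walkC (step (fwd a<b x) (step (bwd a<b y) [])) (s≤s (s≤s z≤n))
                                     uniqueAB ((arc≢ x≢y ∷ []) ∷ [] ∷ []))
        (λ ()) (arc≢ x≢y ∘ balancedDigon⇒≡ (fwd a<b x) (bwd a<b y)) a
        (λ _ → mk⇔ (λ { (here v≡a , _) → v≡a }) (λ { refl → here refl , here refl }))
        (λ { _ (here refl) (here ()) ; _ (here refl) (there (here ())) })

    tightCircuitʳ : ∀ {x y} → x ≢ y → TripleCircuit (joint b) (arc a b a<b x) (arc a b a<b y)
    tightCircuitʳ {x} {y} x≢y _ =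
      tightHandcuff (loopC b) (walkC (step (bwd a<b x) (step (fwd a<b y) [])) (s≤s (s≤s z≤n))
                                     ((<⇒≢ a<b ∘ sym ∷ []) ∷ [] ∷ []) ((arc≢ x≢y ∷ []) ∷ [] ∷ []))
        (λ ()) (arc≢ x≢y ∘ balancedDigon⇒≡ (bwd a<b x) (fwd a<b y)) b
        (λ _ → mk⇔ (λ { (here v≡b , _) → v≡b }) (λ { refl → here refl , here refl }))
        (λ { _ (here refl) (here ()) ; _ (here refl) (there (here ())) })

    looseCircuit : ∀ {x} → TripleCircuit (joint a) (joint b) (arc a b a<b x)
    looseCircuit {x} _ =
      looseHandcuff (loopC a) (loopC b) (λ ()) (λ ()) (λ { _ (here refl) (here a≡b) → <⇒≢ a<b a≡b })
        (step (fwd a<b x) []) uniqueAB (here refl) (here refl)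
        (λ { _ (here v≡a) _ → inj₁ v≡a ; _ (there (here v≡b)) _ → inj₂ v≡b })

    onPair⇒TripleCircuit : ∀ {e₁ e₂ e₃} → OnPair e₁ → OnPair e₂ → OnPair e₃ →
                           e₁ ≢ e₂ → e₁ ≢ e₃ → e₂ ≢ e₃ → TripleCircuit e₁ e₂ e₃
    onPair⇒TripleCircuit jointˡ jointˡ _      e₁≢e₂ _ _ = contradiction refl e₁≢e₂
    onPair⇒TripleCircuit jointʳ jointʳ _      e₁≢e₂ _ _ = contradiction refl e₁≢e₂
    onPair⇒TripleCircuit jointˡ _      jointˡ _ e₁≢e₃ _ = contradiction refl e₁≢e₃
    onPair⇒TripleCircuit jointʳ _      jointʳ _ e₁≢e₃ _ = contradiction refl e₁≢e₃
    onPair⇒TripleCircuit _      jointˡ jointˡ _ _ e₂≢e₃ = contradiction refl e₂≢e₃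
    onPair⇒TripleCircuit _      jointʳ jointʳ _ _ e₂≢e₃ = contradiction refl e₂≢e₃
    onPair⇒TripleCircuit jointˡ    jointʳ    (arcOn _) _ _ _ = looseCircuit
    onPair⇒TripleCircuit jointʳ    jointˡ    (arcOn _) _ _ _ = TripleCircuit-swap₁₂ looseCircuit
    onPair⇒TripleCircuit jointˡ    (arcOn _) jointʳ    _ _ _ = TripleCircuit-swap₂₃ looseCircuit
    onPair⇒TripleCircuit jointʳ    (arcOn _) jointˡ    _ _ _ =
      TripleCircuit-swap₂₃ (TripleCircuit-swap₁₂ looseCircuit)
    onPair⇒TripleCircuit (arcOn _) jointˡ    jointʳ    _ _ _ =
      TripleCircuit-swap₁₂ (TripleCircuit-swap₂₃ looseCircuit)
    onPair⇒TripleCircuit (arcOn _) jointʳ    jointˡ    _ _ _ =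
      TripleCircuit-swap₁₂ (TripleCircuit-swap₂₃ (TripleCircuit-swap₁₂ looseCircuit))
    onPair⇒TripleCircuit jointˡ    (arcOn _) (arcOn _) _ _ e₂≢e₃ = tightCircuitˡ (label≢ e₂≢e₃)
    onPair⇒TripleCircuit jointʳ    (arcOn _) (arcOn _) _ _ e₂≢e₃ = tightCircuitʳ (label≢ e₂≢e₃)
    onPair⇒TripleCircuit (arcOn _) jointˡ    (arcOn _) _ e₁≢e₃ _ =
      TripleCircuit-swap₁₂ (tightCircuitˡ (label≢ e₁≢e₃))
    onPair⇒TripleCircuit (arcOn _) jointʳ    (arcOn _) _ e₁≢e₃ _ =
      TripleCircuit-swap₁₂ (tightCircuitʳ (label≢ e₁≢e₃))
    onPair⇒TripleCircuit (arcOn _) (arcOn _) jointˡ    e₁≢e₂ _ _ =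
      TripleCircuit-swap₂₃ (TripleCircuit-swap₁₂ (tightCircuitˡ (label≢ e₁≢e₂)))
    onPair⇒TripleCircuit (arcOn _) (arcOn _) jointʳ    e₁≢e₂ _ _ =
      TripleCircuit-swap₂₃ (TripleCircuit-swap₁₂ (tightCircuitʳ (label≢ e₁≢e₂)))
    onPair⇒TripleCircuit (arcOn _) (arcOn _) (arcOn _) e₁≢e₂ e₁≢e₃ e₂≢e₃ =
      thetaCircuit (label≢ e₁≢e₂) (label≢ e₁≢e₃) (label≢ e₂≢e₃)

  triangle⇒HasK3 : ∀ {X e₁ e₂ e₃} → e₁ ∈ X → e₂ ∈ X → e₃ ∈ X → e₁ ≢ e₂ → e₁ ≢ e₃ → e₂ ≢ e₃ →
                   TripleCircuit e₁ e₂ e₃ → HasK3 (_∈ X)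
  triangle⇒HasK3 {X} {e₁} {e₂} {e₃} e₁∈X e₂∈X e₃∈X e₁≢e₂ e₁≢e₃ e₂≢e₃ circuit =
    f , lookup-injective uniqueT ,
    (λ i → All.lookup {P = _∈ X} (e₁∈X ∷ e₂∈X ∷ e₃∈X ∷ []) (∈-lookup i)) ,
    λ S → mk⇔ (circuit⇒full S) (full⇒circuit S)
    where
    triangle : List Edge
    triangle = e₁ ∷ e₂ ∷ e₃ ∷ []
    f : Fin 3 → Edge
    f = lookup triangle
    uniqueT : Unique triangle
    uniqueT = (e₁≢e₂ ∷ e₁≢e₃ ∷ []) ∷ (e₂≢e₃ ∷ []) ∷ [] ∷ []
    -- Circuits have three distinct elements, so a circuit inside the triangle is all of it.
    circuit⇒full : ∀ S → IsCircuit (image f S) → K3Circuit S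
    circuit⇒full S c
      with (_ ∷ _ ∷ _ ∷ []) , u , (i₁ , s₁ , refl) ∷ (i₂ , s₂ , refl) ∷ (i₃ , s₃ , refl) ∷ [] , refl
           ← circuit⇒three c
      = λ i → All.lookup {P = λ i → S i ≡ true} (s₁ ∷ s₂ ∷ s₃ ∷ []) (Unique-full⇒∈ (Unique.map⁻ u) refl i)
    full⇒circuit : ∀ S → K3Circuit S → IsCircuit (image f S)
    full⇒circuit S full = circuit (image f S) λ e → mk⇔
      (λ e∈T → index e∈T , full (index e∈T) , sym (lookup-index e∈T))
      (λ { (i , _ , refl) → ∈-lookup i })

  path⇒firstEdges≢ : ∀ {u w x v e e′} (t : Trav u e w) (t′ : Trav w e′ x) (P : Walk x v) →
                     IsPath (step t (step t′ P)) → e ≢ e′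
  path⇒firstEdges≢ t t′ P (u∉ ∷ w∉ ∷ _) refl with incident-Trav t (incident-end t′)
  ... | inj₁ refl = All.lookup u∉ (there (start∈wVerts P)) refl
  ... | inj₂ refl = All.lookup w∉ (start∈wVerts P) refl

  EdgeDisjoint : ∀ {u v} → Walk u v → Walk u v → Set
  EdgeDisjoint P Q = ∀ e → e ∈ wEdges P → e ∉ wEdges Q

  InTheta : ∀ {u v} → Walk u v → Walk u v → Walk u v → Edge → Set
  InTheta P₁ P₂ P₃ e = e ∈ wEdges P₁ ⊎ e ∈ wEdges P₂ ⊎ e ∈ wEdges P₃

  module LabelledArcs (a b : Fin order) where

    Labelled : Edge → Set
    Labelled (joint _)     = ⊥
    Labelled (arc _ _ _ x) = OneOf a b x

    three-labels-impossible : ¬ HasDistinct 3 (OneOf a b)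
    three-labels-impossible =
      ¬HasDistinct (a ∷ b ∷ []) (λ { (inj₁ refl) → here refl ; (inj₂ refl) → there (here refl) }) ℕP.≤-refl

    parallelTriple-unlabelled : ∀ {u v e₁ e₂ e₃} (t₁ : Trav u e₁ v) (t₂ : Trav u e₂ v) (t₃ : Trav u e₃ v) →
                                Labelled e₁ → Labelled e₂ → Labelled e₃ → e₁ ≢ e₂ → e₁ ≢ e₃ → e₂ ≢ e₃ → ⊥
    parallelTriple-unlabelled (fwd p _) (bwd q _) _ _ _ _ _ _ _ = FinP.<-asym p q
    parallelTriple-unlabelled (bwd p _) (fwd q _) _ _ _ _ _ _ _ = FinP.<-asym p q
    parallelTriple-unlabelled (fwd p _) (fwd _ _) (bwd r _) _ _ _ _ _ _ = FinP.<-asym p r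
    parallelTriple-unlabelled (bwd p _) (bwd _ _) (fwd r _) _ _ _ _ _ _ = FinP.<-asym p r
    parallelTriple-unlabelled (fwd p _) (fwd q _) (fwd r _) l₁ l₂ l₃ e₁≢e₂ e₁≢e₃ e₂≢e₃ =
      three-labels-impossible
        (distinct₃ l₁ l₂ l₃ (e₁≢e₂ ∘ arc-cong p q) (e₁≢e₃ ∘ arc-cong p r) (e₂≢e₃ ∘ arc-cong q r))
    parallelTriple-unlabelled (bwd p _) (bwd q _) (bwd r _) l₁ l₂ l₃ e₁≢e₂ e₁≢e₃ e₂≢e₃ =
      three-labels-impossible
        (distinct₃ l₁ l₂ l₃ (e₁≢e₂ ∘ arc-cong p q) (e₁≢e₃ ∘ arc-cong p r) (e₂≢e₃ ∘ arc-cong q r))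

    twoCycles⇒four : ∀ Z₁ Z₂ → (∀ e → e ∈ cEdges Z₁ → e ∉ cEdges Z₂) →
                     (∀ {e} → e ∈ cEdges Z₁ ++ cEdges Z₂ → Labelled e) →
                     HasDistinct 4 (_∈ cEdges Z₁ ++ cEdges Z₂)
    twoCycles⇒four (loopC _) _ _ labelled = ⊥-elim (labelled (here refl))
    twoCycles⇒four (walkC W _ _ _) (loopC _) _ labelled = ⊥-elim (labelled (∈-++⁺ʳ (wEdges W) (here refl)))
    twoCycles⇒four (walkC W₁ len₁ _ u₁) (walkC W₂ len₂ _ u₂) disj _
      with e₁ , e₁′ , e₁∈ , e₁′∈ , e₁≢e₁′ ← twoEdges W₁ len₁ u₁
         | e₂ , e₂′ , e₂∈ , e₂′∈ , e₂≢e₂′ ← twoEdges W₂ len₂ u₂ =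
      distinct₄ (∈-++⁺ˡ e₁∈) (∈-++⁺ˡ e₁′∈) (∈-++⁺ʳ (wEdges W₁) e₂∈) (∈-++⁺ʳ (wEdges W₁) e₂′∈)
        e₁≢e₁′ (disjoint⇒≢ disj e₁∈ e₂∈) (disjoint⇒≢ disj e₁∈ e₂′∈)
        (disjoint⇒≢ disj e₁′∈ e₂∈) (disjoint⇒≢ disj e₁′∈ e₂′∈) e₂≢e₂′

    thetaPaths⇒four : ∀ {u v} (P₁ P₂ P₃ : Walk u v) → u ≢ v → IsPath P₁ → IsPath P₂ → IsPath P₃ →
      EdgeDisjoint P₁ P₂ → EdgeDisjoint P₁ P₃ → EdgeDisjoint P₂ P₃ →
      (∀ {e} → InTheta P₁ P₂ P₃ e → Labelled e) → HasDistinct 4 (InTheta P₁ P₂ P₃)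
    thetaPaths⇒four [] _ _ u≢v _ _ _ _ _ _ _ = contradiction refl u≢v
    thetaPaths⇒four (step _ _) [] _ u≢v _ _ _ _ _ _ _ = contradiction refl u≢v
    thetaPaths⇒four (step _ _) (step _ _) [] u≢v _ _ _ _ _ _ _ = contradiction refl u≢v
    thetaPaths⇒four P₁@(step t₁ (step t₁′ Q)) P₂@(step _ _) (step _ _) _ π₁ _ _ d₁₂ d₁₃ d₂₃ _ =
      distinct₄ (inj₁ (here refl)) (inj₁ (there (here refl)))
                (inj₂ (inj₁ (here refl))) (inj₂ (inj₂ (here refl)))
        (path⇒firstEdges≢ t₁ t₁′ Q π₁)
        (disjoint⇒≢ d₁₂ (here refl) (here refl)) (disjoint⇒≢ d₁₃ (here refl) (here refl))
        (disjoint⇒≢ d₁₂ (there (here refl)) (here refl)) (disjoint⇒≢ d₁₃ (there (here refl)) (here refl))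
        (disjoint⇒≢ d₂₃ (here refl) (here refl))
    thetaPaths⇒four P₁@(step _ []) P₂@(step t₂ (step t₂′ Q)) (step _ _) _ _ π₂ _ d₁₂ d₁₃ d₂₃ _ =
      distinct₄ (inj₂ (inj₁ (here refl))) (inj₂ (inj₁ (there (here refl))))
                (inj₁ (here refl)) (inj₂ (inj₂ (here refl)))
        (path⇒firstEdges≢ t₂ t₂′ Q π₂)
        (disjoint⇒≢ d₁₂ (here refl) (here refl) ∘ sym) (disjoint⇒≢ d₂₃ (here refl) (here refl))
        (disjoint⇒≢ d₁₂ (here refl) (there (here refl)) ∘ sym) (disjoint⇒≢ d₂₃ (there (here refl)) (here refl))
        (disjoint⇒≢ d₁₃ (here refl) (here refl))
    thetaPaths⇒four P₁@(step _ []) P₂@(step _ []) (step t₃ (step t₃′ Q)) _ _ _ π₃ d₁₂ d₁₃ d₂₃ _ =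
      distinct₄ (inj₂ (inj₂ (here refl))) (inj₂ (inj₂ (there (here refl))))
                (inj₁ (here refl)) (inj₂ (inj₁ (here refl)))
        (path⇒firstEdges≢ t₃ t₃′ Q π₃)
        (disjoint⇒≢ d₁₃ (here refl) (here refl) ∘ sym) (disjoint⇒≢ d₂₃ (here refl) (here refl) ∘ sym)
        (disjoint⇒≢ d₁₃ (here refl) (there (here refl)) ∘ sym)
        (disjoint⇒≢ d₂₃ (here refl) (there (here refl)) ∘ sym)
        (disjoint⇒≢ d₁₂ (here refl) (here refl))
    thetaPaths⇒four (step t₁ []) (step t₂ []) (step t₃ []) _ _ _ _ d₁₂ d₁₃ d₂₃ labelled =
      ⊥-elim (parallelTriple-unlabelled t₁ t₂ t₃
        (labelled (inj₁ (here refl))) (labelled (inj₂ (inj₁ (here refl))))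
        (labelled (inj₂ (inj₂ (here refl))))
        (disjoint⇒≢ d₁₂ (here refl) (here refl)) (disjoint⇒≢ d₁₃ (here refl) (here refl))
        (disjoint⇒≢ d₂₃ (here refl) (here refl)))

    module _ (sumFree : SumFree (OneOf a b)) where
      open BalancedTriangles isGroup

      noSum : ∀ {x y z} → OneOf a b x → OneOf a b y → OneOf a b z → x ∙ y ≢ z
      noSum lx ly lz xy≡z = sumFree lx ly (subst (OneOf a b) (sym xy≡z) lz)

      triangle-unbalanced : ∀ {u v w e₁ e₂ e₃} (t₁ : Trav u e₁ v) (t₂ : Trav v e₂ w) (t₃ : Trav w e₃ u) →
                            Labelled e₁ → Labelled e₂ → Labelled e₃ →
                            travGain t₁ ∙ (travGain t₂ ∙ (travGain t₃ ∙ ε)) ≢ ε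
      triangle-unbalanced t₁ t₂ t₃ l₁ l₂ l₃ =
        oriented t₁ t₂ t₃ l₁ l₂ l₃ ∘ trans (cong (λ g → _ ∙ (_ ∙ g)) (sym (identityʳ _)))
        where
        -- Arcs point from the smaller to the larger vertex, so no triangle is cyclically
        -- oriented; up to rotation its gain is x y z⁻¹ or x y⁻¹ z⁻¹ for its labels x, y, z.
        oriented : ∀ {u v w e₁ e₂ e₃} (t₁ : Trav u e₁ v) (t₂ : Trav v e₂ w) (t₃ : Trav w e₃ u) →
                   Labelled e₁ → Labelled e₂ → Labelled e₃ →
                   travGain t₁ ∙ (travGain t₂ ∙ travGain t₃) ≢ ε
        oriented (fwd p _) (fwd q _) (fwd r _) _ _ _ = λ _ → FinP.<-asym (FinP.<-trans p q) r
        oriented (bwd p _) (bwd q _) (bwd r _) _ _ _ = λ _ → FinP.<-asym (FinP.<-trans q p) r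
        oriented (fwd _ _) (fwd _ _) (bwd _ _) l₁ l₂ l₃ = noSum l₁ l₂ l₃ ∘ solve
        oriented (fwd _ _) (bwd _ _) (fwd _ _) l₁ l₂ l₃ = noSum l₃ l₁ l₂ ∘ solve ∘ rotate ∘ rotate
        oriented (bwd _ _) (fwd _ _) (fwd _ _) l₁ l₂ l₃ = noSum l₂ l₃ l₁ ∘ solve ∘ rotate
        oriented (fwd _ _) (bwd _ _) (bwd _ _) l₁ l₂ l₃ = noSum l₃ l₂ l₁ ∘ solve⁻¹
        oriented (bwd _ _) (fwd _ _) (bwd _ _) l₁ l₂ l₃ = noSum l₁ l₃ l₂ ∘ solve⁻¹ ∘ rotate
        oriented (bwd _ _) (bwd _ _) (fwd _ _) l₁ l₂ l₃ = noSum l₂ l₁ l₃ ∘ solve⁻¹ ∘ rotate ∘ rotate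

      labelledCircuit⇒four : ∀ {K} → IsCircuit K → (∀ {e} → K e → Labelled e) → HasDistinct 4 K
      labelledCircuit⇒four (balancedCycle (loopC _) () _)
      labelledCircuit⇒four (balancedCycle (walkC (step _ []) (s≤s ()) _ _) _ _)
      labelledCircuit⇒four (balancedCycle (walkC (step t₁ (step t₂ [])) _ _ ((e₁≢e₂ ∷ _) ∷ _)) bal _) _ =
        contradiction (balancedDigon⇒≡ t₁ t₂ bal) e₁≢e₂
      labelledCircuit⇒four (balancedCycle (walkC (step t₁ (step t₂ (step t₃ []))) _ _ _) bal Z≈K) labelled =
        contradiction bal (triangle-unbalanced t₁ t₂ t₃
          (labelled (⇔⇒⊆ Z≈K (here refl))) (labelled (⇔⇒⊆ Z≈K (there (here refl))))
          (labelled (⇔⇒⊆ Z≈K (there (there (here refl))))))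
      labelledCircuit⇒four (balancedCycle (walkC (step _ (step _ (step _ (step _ _)))) _ _
          ((e₁≢e₂ ∷ e₁≢e₃ ∷ e₁≢e₄ ∷ _) ∷ (e₂≢e₃ ∷ e₂≢e₄ ∷ _) ∷ (e₃≢e₄ ∷ _) ∷ _)) _ Z≈K) _ =
        distinct₄ (⇔⇒⊆ Z≈K (here refl)) (⇔⇒⊆ Z≈K (there (here refl)))
                  (⇔⇒⊆ Z≈K (there (there (here refl)))) (⇔⇒⊆ Z≈K (there (there (there (here refl)))))
                  e₁≢e₂ e₁≢e₃ e₁≢e₄ e₂≢e₃ e₂≢e₄ e₃≢e₄
      labelledCircuit⇒four (tightHandcuff Z₁ Z₂ _ _ _ _ disj Z≈K) labelled =
        HasDistinct-mono (⇔⇒⊆ Z≈K) (twoCycles⇒four Z₁ Z₂ disj (labelled ∘ ⇔⇒⊆ Z≈K))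
      labelledCircuit⇒four (looseHandcuff Z₁ Z₂ _ _ disj P _ _ _ _ Z≈K) labelled =
        HasDistinct-mono (⇔⇒⊆ Z≈K ∘ withPath)
          (twoCycles⇒four Z₁ Z₂ (λ _ e∈Z₁ e∈Z₂ → vertexDisjoint⇒edgeDisjoint Z₁ Z₂ disj e∈Z₁ e∈Z₂ refl)
                          (labelled ∘ ⇔⇒⊆ Z≈K ∘ withPath))
        where
        withPath : ∀ {e} → e ∈ cEdges Z₁ ++ cEdges Z₂ → e ∈ cEdges Z₁ ++ cEdges Z₂ ++ wEdges P
        withPath = subst (_ ∈_) (LP.++-assoc (cEdges Z₁) (cEdges Z₂) (wEdges P)) ∘ ∈-++⁺ˡ
      labelledCircuit⇒four (theta u≢v P₁ P₂ P₃ π₁ π₂ π₃ d₁₂ d₁₃ d₂₃ _ P≈K) labelled =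
        HasDistinct-mono (⇔⇒⊆ P≈K ∘ inTheta)
          (thetaPaths⇒four P₁ P₂ P₃ u≢v π₁ π₂ π₃ (proj₂ d₁₂) (proj₂ d₁₃) (proj₂ d₂₃)
                           (labelled ∘ ⇔⇒⊆ P≈K ∘ inTheta))
        where
        inTheta : ∀ {e} → InTheta P₁ P₂ P₃ e → e ∈ wEdges P₁ ++ wEdges P₂ ++ wEdges P₃
        inTheta = ∈-++₃⁺ (wEdges P₁) (wEdges P₂)

  HasK3⇒smallCircuit : ∀ {X : List Edge} → HasK3 (_∈ X) →
                       ∃[ K ] IsCircuit K × (∀ {e} → K e → e ∈ X) × ¬ HasDistinct 4 K
  HasK3⇒smallCircuit (f , _ , f∈X , circuit⇔full) =
    image f full , Equivalence.from (circuit⇔full full) (λ _ → refl) ,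
    (λ { (i , _ , refl) → f∈X i }) ,
    ¬HasDistinct (map f (allFin 3)) (λ { (i , _ , refl) → ∈-map⁺ f (∈-allFin i) }) ℕP.≤-refl
    where
    full : Fin 3 → Bool
    full _ = true

  module _ {a b : Fin order} (a≢b : a ≢ b) (sumFree : SumFree (OneOf a b)) where
    open LabelledArcs a b

    labelOf : Bool → Fin order
    labelOf false = a
    labelOf true  = b

    labelledArc : Bool × Pair n → Edge
    labelledArc (β , i , j , i<j) = arc i j i<j (labelOf β)

    labelledArc-injective : ∀ {s t} → labelledArc s ≡ labelledArc t → s ≡ t
    labelledArc-injective {false , _} {false , _} refl = refl
    labelledArc-injective {true  , _} {true  , _} refl = refl
    labelledArc-injective {false , _} {true  , _} eq   = contradiction (cong label eq) a≢b
    labelledArc-injective {true  , _} {false , _} eq   = contradiction (sym (cong label eq)) a≢b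

    labelledArcs : List Edge
    labelledArcs = map labelledArc (taggedPairs n)

    length-labelledArcs : length labelledArcs ≡ 2 * (n C 2)
    length-labelledArcs = trans (LP.length-map labelledArc (taggedPairs n)) (length-taggedPairs n)

    labelledArcs-labelled : ∀ {e} → e ∈ labelledArcs → Labelled e
    labelledArcs-labelled e∈ with ∈-map⁻ labelledArc e∈
    ... | (false , _) , _ , refl = inj₁ refl
    ... | (true  , _) , _ , refl = inj₂ refl

    labelledArcs-K3Free : K3Free labelledArcs
    labelledArcs-K3Free =
      Unique.map⁺ labelledArc-injective (Unique-taggedPairs n) ,
      λ hasK3 → let K , circuit , K⊆X , ¬four = HasK3⇒smallCircuit hasK3 in
        ¬four (labelledCircuit⇒four sumFree circuit (labelledArcs-labelled ∘ K⊆X))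

module UpperBound (G : FinGroup) (m : ℕ) where

  n : ℕ
  n = suc (suc m)

  open FinGroup G
  open Frame G n
  open FrameMatroid G n

  OnPairOf : Pair n → Edge → Set
  OnPairOf (_ , _ , i<j) = OnPair i<j

  owner : Edge → Pair n
  owner (joint zero)    = zero , suc zero , s≤s z≤n
  owner (joint (suc k)) = zero , suc k , s≤s z≤n
  owner (arc i j i<j _) = i , j , i<j

  onOwner : ∀ e → OnPairOf (owner e) e
  onOwner (joint zero)    = jointˡ
  onOwner (joint (suc k)) = jointʳ
  onOwner (arc _ _ _ x)   = arcOn x

  rank : Edge → ℕ
  rank (joint i)     = toℕ i
  rank (arc _ _ _ x) = n + toℕ x

  rank-injective : ∀ {e e′} → owner e ≡ owner e′ → rank e ≡ rank e′ → e ≡ e′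
  rank-injective {joint i} {joint j} _ rank≡ = cong joint (FinP.toℕ-injective rank≡)
  rank-injective {joint i} {arc _ _ _ x} _ rank≡ =
    contradiction rank≡ (ℕP.<⇒≢ (ℕP.<-≤-trans (FinP.toℕ<n i) (ℕP.m≤m+n n (toℕ x))))
  rank-injective {arc _ _ _ x} {joint i} _ rank≡ =
    contradiction (sym rank≡) (ℕP.<⇒≢ (ℕP.<-≤-trans (FinP.toℕ<n i) (ℕP.m≤m+n n (toℕ x))))
  rank-injective {arc i j i<j x} {arc _ _ _ y} refl rank≡ =
    cong (arc i j i<j) (FinP.toℕ-injective (ℕP.+-cancelˡ-≡ n (toℕ x) (toℕ y) rank≡))

  rank<⇒≢ : ∀ {e e′} → rank e < rank e′ → e ≢ e′
  rank<⇒≢ e<e′ refl = ℕP.<-irrefl refl e<e′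

  _≟ᵖ_ : (o o′ : Pair n) → Dec (o ≡ o′)
  (i , j , i<j) ≟ᵖ (i′ , j′ , i′<j′) with i FinP.≟ i′ | j FinP.≟ j′
  ... | yes refl | yes refl = yes (cong (λ r → i , j , r) (FinP.<-irrelevant i<j i′<j′))
  ... | no i≢i′  | _        = no (i≢i′ ∘ cong proj₁)
  ... | _        | no j≢j′  = no (j≢j′ ∘ cong (proj₁ ∘ proj₂))

  module _ {X : List Edge} (X-K3Free : K3Free X) where

    no-three-on-a-pair : ∀ o {d e f} → OnPairOf o d → OnPairOf o e → OnPairOf o f →
                         d ∈ X → e ∈ X → f ∈ X → d ≢ e → d ≢ f → e ≢ f → ⊥
    no-three-on-a-pair (_ , _ , i<j) on-d on-e on-f d∈X e∈X f∈X d≢e d≢f e≢f =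
      proj₂ X-K3Free (triangle⇒HasK3 d∈X e∈X f∈X d≢e d≢f e≢f
                        (onPair⇒TripleCircuit i<j on-d on-e on-f d≢e d≢f e≢f))

    Below : Edge → Edge → Set
    Below e d = owner d ≡ owner e × rank d < rank e

    below? : ∀ e → Dec (Any (Below e) X)
    below? e = any? (λ d → (owner d ≟ᵖ owner e) ×-dec (rank d ℕP.<? rank e)) X

    -- X has at most two elements on each pair, so an element is determined by its pair
    -- and by whether a smaller-ranked element of X lies on the same pair.
    slot : Edge → Bool × Pair n
    slot e = does (below? e) , owner e

    below⇒no-other : ∀ {d e f} → d ∈ X → e ∈ X → f ∈ X → Below e d →
                     owner f ≡ owner e → rank e < rank f → ⊥
    below⇒no-other {d} {e} {f} d∈X e∈X f∈X (d~e , d<e) f~e e<f =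
      no-three-on-a-pair (owner e) (subst (λ o → OnPairOf o d) d~e (onOwner d)) (onOwner e)
        (subst (λ o → OnPairOf o f) f~e (onOwner f)) d∈X e∈X f∈X
        (rank<⇒≢ d<e) (rank<⇒≢ (ℕP.<-trans d<e e<f)) (rank<⇒≢ e<f)

    slot-collision : ∀ {e e′} → e ∈ X → e′ ∈ X → owner e ≡ owner e′ →
                     does (below? e) ≡ does (below? e′) → rank e < rank e′ → ⊥
    slot-collision {e} {e′} e∈X e′∈X e~e′ flag≡ e<e′ with below? e | below? e′
    ... | _            | no ∄below = ∄below (lose e∈X (e~e′ , e<e′))
    ... | no _         | yes _     with () ← flag≡
    ... | yes ∃below   | yes _     with d , d∈X , d-below ← find ∃below =
      below⇒no-other d∈X e∈X e′∈X d-below (sym e~e′) e<e′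

    slot-injective : ∀ {e e′} → e ∈ X → e′ ∈ X → slot e ≡ slot e′ → e ≡ e′
    slot-injective {e} {e′} e∈X e′∈X slot≡ with ℕP.<-cmp (rank e) (rank e′)
    ... | tri≈ _ rank≡ _ = rank-injective (cong proj₂ slot≡) rank≡
    ... | tri< e<e′ _ _ = ⊥-elim (slot-collision e∈X e′∈X (cong proj₂ slot≡) (cong proj₁ slot≡) e<e′)
    ... | tri> _ _ e′<e =
      ⊥-elim (slot-collision e′∈X e∈X (cong proj₂ (sym slot≡)) (cong proj₁ (sym slot≡)) e′<e)

    Unique-slots : Unique (map slot X)
    Unique-slots = Unique-map⁺-on slot slot-injective (proj₁ X-K3Free)

    slot∈taggedPairs : ∀ {s} → s ∈ map slot X → s ∈ taggedPairs n
    slot∈taggedPairs s∈ with e , _ , refl ← ∈-map⁻ slot s∈ = ∈-taggedPairs _ _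

    K3Free⇒length≤ : length X ≤ 2 * (n C 2)
    K3Free⇒length≤ = subst₂ _≤_ (LP.length-map slot X) (length-taggedPairs n)
      (Unique-⊆⇒length≤ Unique-slots slot∈taggedPairs)

    module _ (3≤n : 3 ≤ n) where

      two : V
      two = Fin.fromℕ< 3≤n

      otherPair : ∀ i → ∃[ o ] OnPairOf o (joint i) × owner (joint i) ≢ o
      otherPair zero =
        (zero , two , subst (0 <_) (sym (FinP.toℕ-fromℕ< 3≤n)) (s≤s z≤n)) , jointˡ ,
        λ eq → case trans (cong (toℕ ∘ proj₁ ∘ proj₂) eq) (FinP.toℕ-fromℕ< 3≤n) of λ ()
      otherPair (suc zero) =
        (suc zero , two , subst (1 <_) (sym (FinP.toℕ-fromℕ< 3≤n)) (s≤s (s≤s z≤n))) , jointˡ ,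
        λ eq → case cong proj₁ eq of λ ()
      otherPair (suc (suc k)) =
        (suc zero , suc (suc k) , s≤s (s≤s z≤n)) , jointʳ , λ eq → case cong proj₁ eq of λ ()

      joint∈⇒length< : ∀ {i} → joint i ∈ X → length X < 2 * (n C 2)
      joint∈⇒length< {i} i∈X with o , on-o , owner≢o ← otherPair i =
        subst₂ _≤_ (cong suc (LP.length-map slot X)) (length-taggedPairs n)
          (Unique-⊆⇒length≤ (¬Any⇒All¬ (map slot X) unused ∷ Unique-slots) λ where
            (here refl) → ∈-taggedPairs true o
            (there s∈)  → slot∈taggedPairs s∈)
        where
        unused : (true , o) ∉ map slot X
        unused s∈ with ∈-map⁻ slot s∈
        ... | e , e∈X , slot≡ with below? e | cong proj₁ slot≡ | cong proj₂ slot≡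
        ...   | yes ∃below | _ | o≡e with d , d∈X , (d~e , d<e) ← find ∃below =
          no-three-on-a-pair o on-o (subst (λ o → OnPairOf o d) (trans d~e (sym o≡e)) (onOwner d))
            (subst (λ o → OnPairOf o e) (sym o≡e) (onOwner e)) i∈X d∈X e∈X
            (λ { refl → owner≢o (trans d~e (sym o≡e)) }) (λ { refl → owner≢o (sym o≡e) })
            (rank<⇒≢ d<e)

theorem4p5 : (G : FinGroup) → 4 ≤ FinGroup.order G → (n : ℕ) → 2 ≤ n →
    Frame.ExEquals G n (2 * (n C 2)) ×
    (3 ≤ n → (X : List (Frame.Edge G n)) → Frame.K3Free G n X →
      length X ≡ 2 * (n C 2) → (i : Frame.V G n) → Frame.joint i ∉ X)
theorem4p5 _ _ (suc zero) (s≤s ())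
theorem4p5 G 4≤order n@(suc (suc m)) _
  with _ , _ , a≢b , sumFree ← ∃-sumFreePair G 4≤order =
  ((labelledArcs a≢b sumFree , labelledArcs-K3Free a≢b sumFree , length-labelledArcs a≢b sumFree) ,
   λ _ → K3Free⇒length≤) ,
  λ 3≤n _ X-K3Free length≡ _ i∈X → ℕP.<-irrefl length≡ (joint∈⇒length< X-K3Free 3≤n i∈X)
  where
  open FrameMatroid G n
  open UpperBound G m
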